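{- Let $r \ge 1$ and let $rK_2$ denote the graph consisting of $r$ pairwise disjoint edges (a perfect matching on $2r$ vertices). In any lettering of $rK_2$, no letter encodes more than $2$ vertices.
   Context: Given a finite alphabet $\Sigma$, a set $D \subseteq \Sigma^2$ (the decoder), and a word $w = w_1 \dots w_n$ with each $w_i \in \Sigma$, the letter graph $\Gamma_D(w)$ is the simple graph with vertex set $\{1,\dots,n\}$ in which, for $p < q$, the vertices $p$ and $q$ are adjacent if and only if $(w_p, w_q) \in D$. A lettering of a graph $G$ is a letter graph $\Gamma_D(w)$ isomorphic to $G$; an $r$-lettering is one where the word $w$ uses an alphabet of size $r$. In a letter graph $\Gamma_D(w)$, a letter $a \in \Sigma$ encodes the set of vertices $\{i : w_i = a\}$. -}

module Defs where

open import Data.Nat using (ℕ; _*_; _<_)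
open import Data.Fin using (Fin; toℕ) renaming (_<_ to _<ᶠ_)
open import Data.Nat.DivMod using (_/_)
open import Data.Product using (_×_; Σ)
open import Data.Sum using (_⊎_)
open import Relation.Nullary using (¬_)
open import Relation.Binary.PropositionalEquality using (_≡_; _≢_)
open import Function.Bundles using (_⤖_; Bijection)

record Graph (n : ℕ) : Set₁ where
  field
    Adj       : Fin n → Fin n → Set
    irrefl    : ∀ i → ¬ Adj i i
    symmetric : ∀ i j → Adj i j → Adj j i
open Graph public

-- Letter graph Γ_D(w): alphabet Fin s (finite), decoder D ⊆ Σ², word w of length n
-- (positions Fin n).  For p < q, p ~ q iff (w p , w q) ∈ D.
LetterAdj : {s n : ℕ} → (Fin s → Fin s → Set) → (Fin n → Fin s) → Fin n → Fin n → Set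
LetterAdj D w p q = (p <ᶠ q × D (w p) (w q)) ⊎ (q <ᶠ p × D (w q) (w p))

IsLettering : {s n : ℕ} → Graph n → (Fin s → Fin s → Set) → (Fin n → Fin s) → Set
IsLettering {n = n} G D w =
  Σ (Fin n ⤖ Fin n) λ f →
    ∀ p q → (LetterAdj D w p q → Adj G (Bijection.to f p) (Bijection.to f q))
          × (Adj G (Bijection.to f p) (Bijection.to f q) → LetterAdj D w p q)

-- rK₂ on vertex set Fin (2r): vertices 2k and 2k+1 are joined, for k < r.
matchAdj : (r : ℕ) → Fin (2 * r) → Fin (2 * r) → Set
matchAdj r i j = (i ≢ j) × (toℕ i / 2 ≡ toℕ j / 2)

rK₂ : (r : ℕ) → Graph (2 * r)
rK₂ r = record
  { Adj = matchAdj r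
  ; irrefl = λ i h → Data.Product.proj₁ h Relation.Binary.PropositionalEquality.refl
  ; symmetric = λ i j h →
      (λ e → Data.Product.proj₁ h (Relation.Binary.PropositionalEquality.sym e))
      Data.Product., Relation.Binary.PropositionalEquality.sym (Data.Product.proj₂ h)
  }
  where import Data.Product
        import Relation.Binary.PropositionalEquality

module Submission where

-- In a perfect matching rK₂ every vertex has exactly one neighbour.  Being
-- "one-regular" in this sense is invariant under isomorphism, so the letter
-- graph Γ_D(w) of any lettering of rK₂ is one-regular as well.  Now suppose
-- three positions p < q < t carry the same letter a, and let m be the unique
-- neighbour of q in Γ_D(w).  If q < m then (a , w m) ∈ D, so p is adjacent to
-- m as well; if m < q then (w m , a) ∈ D, so m is adjacent to t as well.
-- Either way m has two distinct neighbours, which is impossible.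

open import Defs
open import Data.Nat using (ℕ; zero; suc; _+_; _*_; _≤_; _<_; z≤n; s≤s)
open import Data.Nat.Properties using (suc-injective; +-suc; +-identityʳ)
open import Data.Nat.DivMod using (_/_; _%_; m/n≡1+[m∸n]/n; m≡m%n+[m/n]*n; m%n<n)
open import Data.Fin as Fin using (Fin; toℕ; fromℕ<) renaming (_<_ to _<ᶠ_)
open import Data.Fin.Properties using (toℕ-injective; toℕ-fromℕ<; toℕ<n; <-cmp; <-trans; <-irrefl)
open import Data.Product using (_×_; ∃; _,_; proj₁; proj₂)
open import Data.Sum using (_⊎_; inj₁; inj₂)
open import Data.Empty using (⊥; ⊥-elim)
open import Relation.Nullary using (¬_; yes; no)
open import Function using (_∘_)
open import Relation.Binary using (tri<; tri≈; tri>)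
open import Relation.Binary.PropositionalEquality
  using (_≡_; _≢_; refl; sym; trans; cong; cong₂; subst; module ≡-Reasoning)
open import Function.Bundles using (Bijection)

half-suc-suc : ∀ n → suc (suc n) / 2 ≡ suc (n / 2)
half-suc-suc n = m/n≡1+[m∸n]/n {suc (suc n)} {2} (s≤s (s≤s z≤n))

half-parity-injective : ∀ a b → a / 2 ≡ b / 2 → a % 2 ≡ b % 2 → a ≡ b
half-parity-injective a b same-half same-parity = begin
  a                   ≡⟨ m≡m%n+[m/n]*n a 2 ⟩
  a % 2 + a / 2 * 2   ≡⟨ cong₂ (λ e h → e + h * 2) same-parity same-half ⟩
  b % 2 + b / 2 * 2   ≡⟨ sym (m≡m%n+[m/n]*n b 2) ⟩
  b                   ∎
  where open ≡-Reasoning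

two-bits-of-three-agree : ∀ {x y z} → x < 2 → y < 2 → z < 2 → x ≡ y ⊎ x ≡ z ⊎ y ≡ z
two-bits-of-three-agree (s≤s z≤n)       (s≤s z≤n)       _               = inj₁ refl
two-bits-of-three-agree (s≤s (s≤s z≤n)) (s≤s (s≤s z≤n)) _               = inj₁ refl
two-bits-of-three-agree (s≤s z≤n)       (s≤s (s≤s z≤n)) (s≤s z≤n)       = inj₂ (inj₁ refl)
two-bits-of-three-agree (s≤s z≤n)       (s≤s (s≤s z≤n)) (s≤s (s≤s z≤n)) = inj₂ (inj₂ refl)
two-bits-of-three-agree (s≤s (s≤s z≤n)) (s≤s z≤n)       (s≤s z≤n)       = inj₂ (inj₂ refl)
two-bits-of-three-agree (s≤s (s≤s z≤n)) (s≤s z≤n)       (s≤s (s≤s z≤n)) = inj₂ (inj₁ refl)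

no-three-share-a-half : ∀ a b c → a / 2 ≡ b / 2 → a / 2 ≡ c / 2 →
                        a ≢ b → a ≢ c → b ≢ c → ⊥
no-three-share-a-half a b c ab ac a≢b a≢c b≢c
  with two-bits-of-three-agree (m%n<n a 2) (m%n<n b 2) (m%n<n c 2)
... | inj₁ pab        = a≢b (half-parity-injective a b ab pab)
... | inj₂ (inj₁ pac) = a≢c (half-parity-injective a c ac pac)
... | inj₂ (inj₂ pbc) = b≢c (half-parity-injective b c (trans (sym ab) ac) pbc)

-- The mate of n in the matching {2k, 2k+1}: flip the lowest bit.
mate : ℕ → ℕ
mate zero          = 1
mate (suc zero)    = 0
mate (suc (suc n)) = suc (suc (mate n))

mate-≢ : ∀ n → mate n ≢ n
mate-≢ zero          ()
mate-≢ (suc zero)    ()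
mate-≢ (suc (suc n)) e = mate-≢ n (suc-injective (suc-injective e))

mate-half : ∀ n → mate n / 2 ≡ n / 2
mate-half zero          = refl
mate-half (suc zero)    = refl
mate-half (suc (suc n)) = begin
  suc (suc (mate n)) / 2  ≡⟨ half-suc-suc (mate n) ⟩
  suc (mate n / 2)        ≡⟨ cong suc (mate-half n) ⟩
  suc (n / 2)             ≡⟨ sym (half-suc-suc n) ⟩
  suc (suc n) / 2         ∎
  where open ≡-Reasoning

mate-< : ∀ n r → n < r + r → mate n < r + r
mate-< n             zero    ()
mate-< zero          (suc r) _ rewrite +-suc r r = s≤s (s≤s z≤n)
mate-< (suc zero)    (suc r) _ rewrite +-suc r r = s≤s z≤n
mate-< (suc (suc n)) (suc r) (s≤s n<) rewrite +-suc r r with s≤s n<′ ← n< =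
  s≤s (s≤s (mate-< n r n<′))

record OneRegular {n : ℕ} (A : Fin n → Fin n → Set) : Set where
  field
    neighbour        : ∀ x → ∃ (A x)
    unique-neighbour : ∀ {x y z} → A x y → A x z → y ≡ z
open OneRegular

matching-one-regular : ∀ r → OneRegular (matchAdj r)
matching-one-regular r .neighbour x = y , y≢x ∘ sym , sym y-half
  where
  mate<2r : mate (toℕ x) < 2 * r
  mate<2r = subst (mate (toℕ x) <_) (sym 2r≡r+r)
              (mate-< (toℕ x) r (subst (toℕ x <_) 2r≡r+r (toℕ<n x)))
    where
    2r≡r+r : 2 * r ≡ r + r
    2r≡r+r = cong (r +_) (+-identityʳ r)
  y : Fin (2 * r)
  y = fromℕ< mate<2r
  y≢x : y ≢ x
  y≢x e = mate-≢ (toℕ x) (trans (sym (toℕ-fromℕ< mate<2r)) (cong toℕ e))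
  y-half : toℕ y / 2 ≡ toℕ x / 2
  y-half = trans (cong (_/ 2) (toℕ-fromℕ< mate<2r)) (mate-half (toℕ x))
matching-one-regular r .unique-neighbour {x} {y} {z} (x≢y , xy) (x≢z , xz)
  with y Fin.≟ z
... | yes y≡z = y≡z
... | no  y≢z = ⊥-elim (no-three-share-a-half (toℕ x) (toℕ y) (toℕ z) xy xz
                  (x≢y ∘ toℕ-injective) (x≢z ∘ toℕ-injective) (y≢z ∘ toℕ-injective))

letterAdj-sym : ∀ {s n} (D : Fin s → Fin s → Set) (w : Fin n → Fin s) {p q} →
                LetterAdj D w p q → LetterAdj D w q p
letterAdj-sym D w (inj₁ pq) = inj₂ pq
letterAdj-sym D w (inj₂ qp) = inj₁ qp

-- One-regularity transfers from a graph to any of its letterings: pull the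
-- neighbour back along the bijection, and push uniqueness forward.
lettering-one-regular : ∀ {s n} (G : Graph n) (D : Fin s → Fin s → Set) (w : Fin n → Fin s) →
                        IsLettering G D w → OneRegular (Adj G) → OneRegular (LetterAdj D w)
lettering-one-regular {n = n} G D w (f , iso) reg .neighbour p = m , proj₂ (iso p m) adj-p-m
  where
  open Bijection f using (to; strictlySurjective)
  y : Fin n
  y = proj₁ (reg .neighbour (to p))
  m : Fin n
  m = proj₁ (strictlySurjective y)
  adj-p-m : Adj G (to p) (to m)
  adj-p-m = subst (Adj G (to p)) (sym (proj₂ (strictlySurjective y))) (proj₂ (reg .neighbour (to p)))
lettering-one-regular G D w (f , iso) reg .unique-neighbour {p} {q} {t} pq pt =
  Bijection.injective f (reg .unique-neighbour (proj₁ (iso p q) pq) (proj₁ (iso p t) pt))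

-- In a one-regular letter graph no letter occurs at three sorted positions
-- p < q < t: the neighbour m of q would also be adjacent to p (if q < m) or
-- to t (if m < q).
no-sorted-triple : ∀ {s n} (D : Fin s → Fin s → Set) (w : Fin n → Fin s) →
                   OneRegular (LetterAdj D w) → (a : Fin s) → ∀ {p q t} →
                   p <ᶠ q → q <ᶠ t → w p ≡ a → w q ≡ a → w t ≡ a → ⊥
no-sorted-triple D w reg a {p} {q} {t} p<q q<t wp wq wt
  with reg .neighbour q
... | m , inj₁ (q<m , Dqm) = <-irrefl p≡q p<q
  where
  adj-p-m : LetterAdj D w p m
  adj-p-m = inj₁ (<-trans p<q q<m , subst (λ x → D x (w m)) (trans wq (sym wp)) Dqm)
  p≡q : p ≡ q
  p≡q = reg .unique-neighbour (letterAdj-sym D w adj-p-m) (inj₂ (q<m , Dqm))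
... | m , inj₂ (m<q , Dmq) = <-irrefl q≡t q<t
  where
  adj-m-t : LetterAdj D w m t
  adj-m-t = inj₁ (<-trans m<q q<t , subst (D (w m)) (trans wq (sym wt)) Dmq)
  q≡t : q ≡ t
  q≡t = reg .unique-neighbour (inj₁ (m<q , Dmq)) adj-m-t

no-distinct-triple : ∀ {n} (P : Fin n → Set) →
                     (∀ {p q t} → p <ᶠ q → q <ᶠ t → P p → P q → P t → ⊥) →
                     ∀ {i j k} → i ≢ j → i ≢ k → j ≢ k → P i → P j → P k → ⊥
no-distinct-triple P sorted {i} {j} {k} i≢j i≢k j≢k Pi Pj Pk
  with <-cmp i j | <-cmp i k | <-cmp j k
... | tri≈ _ i≡j _ | _            | _            = i≢j i≡j
... | _            | tri≈ _ i≡k _ | _            = i≢k i≡k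
... | _            | _            | tri≈ _ j≡k _ = j≢k j≡k
... | tri< i<j _ _ | tri< _ _ _   | tri< j<k _ _ = sorted i<j j<k Pi Pj Pk
... | tri< _ _ _   | tri< i<k _ _ | tri> _ _ k<j = sorted i<k k<j Pi Pk Pj
... | tri< i<j _ _ | tri> _ _ k<i | _            = sorted k<i i<j Pk Pi Pj
... | tri> _ _ j<i | tri< i<k _ _ | _            = sorted j<i i<k Pj Pi Pk
... | tri> _ _ _   | tri> _ _ k<i | tri< j<k _ _ = sorted j<k k<i Pj Pk Pi
... | tri> _ _ j<i | tri> _ _ _   | tri> _ _ k<j = sorted k<j j<i Pk Pj Pi

-- In any lettering of rK₂ no letter encodes more than two vertices.
lemma2 : (r : ℕ) → 1 ≤ r → (s : ℕ) → (D : Fin s → Fin s → Set) → (w : Fin (2 * r) → Fin s) →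
    IsLettering (rK₂ r) D w →
    (a : Fin s) → (i j k : Fin (2 * r)) → i ≢ j → i ≢ k → j ≢ k →
    ¬ ((w i ≡ a) × (w j ≡ a) × (w k ≡ a))
lemma2 r _ s D w lettering a i j k i≢j i≢k j≢k (wi , wj , wk) =
  no-distinct-triple (λ x → w x ≡ a) (no-sorted-triple D w letter-graph-regular a)
    i≢j i≢k j≢k wi wj wk
  where
  letter-graph-regular : OneRegular (LetterAdj D w)
  letter-graph-regular =
    lettering-one-regular (rK₂ r) D w lettering (matching-one-regular r)
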